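{- Let $T$ be a tree with $n$ vertices and let $e_a,e_b$ be distinct edges of $T$ with $\theta_T(e_a)=(n-i,i)$ and $\theta_T(e_b)=(n-k,k)$, where $i\ge k$. If $k=i$, then $\theta_T(\{e_a,e_b\})=\mathrm{re}(n-2i,i,i)$. If $k<i$, then $\theta_T(\{e_a,e_b\})$ is either $\mathrm{re}(n-i-k,i,k)$ or $\mathrm{re}(n-i,i-k,k)$.
   Context: For a finite tree $T$ and a set $S\subseteq E(T)$, $\theta_T(S)$ is the partition of $\#V(T)$ whose parts are the numbers of vertices of the connected components of the graph $(V(T),E(T)\setminus S)$; for a single edge $e$ write $\theta_T(e)=\theta_T(\{e\})$. Partitions are written with parts in weakly decreasing order. For positive integers $a_1,\dots,a_r$, $\mathrm{re}(a_1,\dots,a_r)$ denotes the partition whose parts are $a_1,\dots,a_r$ (sorted into weakly decreasing order). -}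

module Defs where

open import Data.Nat using (ℕ; _≤ᵇ_; _≥_)
open import Data.Fin using (Fin; _≟_)
open import Data.Product using (Σ; _×_; _,_; proj₁; proj₂; ∃)
open import Data.Sum using (_⊎_)
open import Data.Bool using (if_then_else_)
open import Data.List using (List; []; _∷_; length; filter; map; foldr)
open import Data.List.Relation.Unary.Linked using (Linked)
open import Data.List.Relation.Binary.Permutation.Propositional using (_↭_)
open import Data.List using () renaming (allFin to allFinL)
open import Relation.Binary.PropositionalEquality using (_≡_)
open import Relation.Nullary using (¬_)
open import Data.Empty using (⊥)

-- A (multi)graph on vertex set Fin n with m edges, edge j having endpoints E j.
Edges : ℕ → ℕ → Set
Edges m n = Fin m → Fin n × Fin n

Joins : ∀ {n} → Fin n × Fin n → Fin n → Fin n → Set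
Joins (x , y) u v = (x ≡ u × y ≡ v) ⊎ (x ≡ v × y ≡ u)

-- Reach E S u v : u and v are connected in the graph (V, E \ S),
-- where S ⊆ E(T) is given as a predicate on edge indices.
data Reach {m n} (E : Edges m n) (S : Fin m → Set) : Fin n → Fin n → Set where
  here : ∀ {u} → Reach E S u u
  step : ∀ {u v w} (j : Fin m) → ¬ S j → Joins (E j) u v → Reach E S v w → Reach E S u w

NoEdge : ∀ {m} → Fin m → Set
NoEdge _ = ⊥

SingleEdge : ∀ {m} → Fin m → Fin m → Set
SingleEdge a j = j ≡ a

TwoEdges : ∀ {m} → Fin m → Fin m → Fin m → Set
TwoEdges a b j = j ≡ a ⊎ j ≡ b

-- A tree: connected, and acyclic (no edge lies on a cycle, i.e. the two
-- endpoints of any edge e are not connected in T - e).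
record IsTree {m n} (E : Edges m n) : Set where
  field
    connected : ∀ u v → Reach E NoEdge u v
    acyclic   : ∀ j → ¬ Reach E (SingleEdge j) (proj₁ (E j)) (proj₂ (E j))

Decreasing : List ℕ → Set
Decreasing = Linked _≥_

fiberSize : ∀ {n r} → (Fin n → Fin r) → Fin r → ℕ
fiberSize {n} c j = length (filter (λ u → c u ≟ j) (allFinL n))

-- θ E S λ : "θ_T(S) = λ", i.e. λ is the partition (weakly decreasing list)
-- of the numbers of vertices of the connected components of (V, E \ S).
θ : ∀ {m n} → Edges m n → (Fin m → Set) → List ℕ → Set
θ {m} {n} E S λ′ =
  Decreasing λ′ ×
  Σ ℕ λ r → Σ (Fin n → Fin r) λ c →
    (∀ j → ∃ λ u → c u ≡ j) ×
    (∀ u v → c u ≡ c v → Reach E S u v) ×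
    (∀ u v → Reach E S u v → c u ≡ c v) ×
    (map (fiberSize c) (allFinL r) ↭ λ′)

insertDesc : ℕ → List ℕ → List ℕ
insertDesc x [] = x ∷ []
insertDesc x (y ∷ ys) = if y ≤ᵇ x then x ∷ y ∷ ys else y ∷ insertDesc x ys

re : List ℕ → List ℕ
re = foldr insertDesc []

-- Write T − a = A₀ ⊔ A₁ and T − b = B₀ ⊔ B₁.  Since b ≠ a, the edge b lies inside one
-- side A_α of a, and its endpoints lie on different sides of b.  Every path of T − a
-- that crosses b reaches an endpoint of b first, so two vertices are connected in
-- T − {a, b} iff they lie on the same side of a and on the same side of b.  The far
-- side A_{1−α} is connected without using b, hence sits inside a single side B_β of b;
-- so the components of T − {a, b} are A_{1−α}, A_α ∩ B_β ≠ ∅ and A_α ∩ B_{1−β} = B_{1−β},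
-- of sizes X, Y, Z with {Y + Z, X} = {n − i, i} and {X + Y, Z} = {n − k, k}.  As
-- X ≥ i ≥ k and Y ≥ 1, necessarily Z = k, and X ∈ {i, n − i} gives the two cases.
module Submission where

open import Defs
open import Data.Nat using (ℕ; suc; _∸_; _*_; _≤_; _<_; _+_)
open import Data.Nat.Properties
  using (≤-decTotalOrder; ≤-trans; ≤-reflexive; m+1+n≰m; m+n∸n≡m; ∸-+-assoc; +-identityʳ; +-suc;
         <⇒≢; n∸n≡0)
open import Data.Fin using (Fin; _≟_)
open import Data.Fin.Patterns using (0F; 1F; 2F)
open import Data.Product using (_×_; _,_; proj₁; proj₂; Σ; ∃)
import Data.Product as Product
open import Data.Sum using (_⊎_; inj₁; inj₂)
import Data.Sum as Sum
open import Data.List using ([]; _∷_; [_]; length; filter; map)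
open import Data.List using () renaming (allFin to allFinL)
open import Data.List.Properties
  using (length-map; length-tabulate; filter-≐; filter-accept; filter-reject; filter-some)
open import Data.List.Relation.Unary.Any using (here; there)
open import Data.List.Relation.Unary.Linked using (_∷_)
open import Data.List.Membership.Propositional using (lose)
open import Data.List.Membership.Propositional.Properties using (∈-allFin)
open import Data.List.Relation.Binary.Permutation.Propositional
  using (_↭_; swap; ↭-refl; ↭-reflexive; ↭-sym; ↭-trans)
open import Data.List.Relation.Binary.Permutation.Propositional.Properties
  using (↭-length; ↭-singleton-inv; ∈-resp-↭; drop-mid)
import Relation.Binary.Construct.Flip.EqAndOrd as Flip
open import Data.List.Sort.InsertionSort.Base (Flip.decTotalOrder ≤-decTotalOrder) using (insert; sort)
open import Data.List.Sort.InsertionSort.Properties (Flip.decTotalOrder ≤-decTotalOrder) using (sort-↭; sort-↗)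
open import Function using (_∘_; id)
open import Relation.Binary.PropositionalEquality using (_≡_; _≢_; refl; sym; trans; cong; cong₂; subst)
open import Relation.Nullary using (¬_; yes; no)
open import Relation.Unary using (Pred; Decidable; _⊆_; _≐_; _∪_)
open import Data.Empty using (⊥-elim)

insertDesc≡insert : ∀ x ys → insertDesc x ys ≡ insert x ys
insertDesc≡insert x [] = refl
insertDesc≡insert x (y ∷ ys) rewrite insertDesc≡insert x ys = refl

re≡sort : ∀ xs → re xs ≡ sort xs
re≡sort [] = refl
re≡sort (x ∷ xs) rewrite re≡sort xs = insertDesc≡insert x (sort xs)

re-decreasing : ∀ xs → Decreasing (re xs)
re-decreasing xs = subst Decreasing (sym (re≡sort xs)) (sort-↗ xs)

re-↭ : ∀ xs → re xs ↭ xs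
re-↭ xs = subst (_↭ xs) (sym (re≡sort xs)) (sort-↭ xs)

↭-pair-inv : ∀ {A : Set} {x y u v : A} → x ∷ y ∷ [] ↭ u ∷ v ∷ [] →
  (x ≡ u × y ≡ v) ⊎ (x ≡ v × y ≡ u)
↭-pair-inv p with ∈-resp-↭ p (here refl)
... | here refl with ↭-singleton-inv (drop-mid [] [] p)
...   | refl = inj₁ (refl , refl)
↭-pair-inv {u = u} p | there (here refl) with ↭-singleton-inv (drop-mid [] [ u ] p)
...   | refl = inj₂ (refl , refl)

module _ {a p q r} {A : Set a} {P : Pred A p} {Q : Pred A q} {R : Pred A r}
         (P? : Decidable P) (Q? : Decidable Q) (R? : Decidable R) where

  length-filter-∪ : P ≐ Q ∪ R → (∀ {x} → Q x → ¬ R x) →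
    ∀ xs → length (filter P? xs) ≡ length (filter Q? xs) + length (filter R? xs)
  length-filter-∪ P≐Q∪R disjoint [] = refl
  length-filter-∪ P≐Q∪R disjoint (x ∷ xs) with Q? x | R? x
  ... | yes q | yes r = ⊥-elim (disjoint q r)
  ... | yes q | no _ =
    trans (cong length (filter-accept P? (proj₂ P≐Q∪R (inj₁ q))))
          (cong suc (length-filter-∪ P≐Q∪R disjoint xs))
  ... | no _ | yes r =
    trans (cong length (filter-accept P? (proj₂ P≐Q∪R (inj₂ r))))
          (trans (cong suc (length-filter-∪ P≐Q∪R disjoint xs)) (sym (+-suc _ _)))
  ... | no ¬q | no ¬r =
    trans (cong length (filter-reject P? (Sum.[ ¬q , ¬r ] ∘ proj₁ P≐Q∪R)))
          (length-filter-∪ P≐Q∪R disjoint xs)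

module _ {n r s : ℕ} (c : Fin n → Fin r) (d : Fin n → Fin s) where

  fiberSize-≐ : ∀ {j k} → (λ u → c u ≡ j) ≐ (λ u → d u ≡ k) → fiberSize c j ≡ fiberSize d k
  fiberSize-≐ fibers = cong length (filter-≐ _ _ fibers (allFinL n))

  fiberSize-∪ : ∀ {j k l} → k ≢ l → (λ u → c u ≡ j) ≐ (λ u → d u ≡ k) ∪ (λ u → d u ≡ l) →
    fiberSize c j ≡ fiberSize d k + fiberSize d l
  fiberSize-∪ k≢l fibers =
    length-filter-∪ _ _ _ fibers (λ dk dl → k≢l (trans (sym dk) dl)) (allFinL n)

fiberSize-nonempty : ∀ {n r} (c : Fin n → Fin r) {u j} → c u ≡ j → 0 < fiberSize c j
fiberSize-nonempty c {u} cu≡j = filter-some _ (lose (∈-allFin u) cu≡j)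

length-fiberSizes : ∀ {n r} (c : Fin n → Fin r) → length (map (fiberSize c) (allFinL r)) ≡ r
length-fiberSizes {r = r} c = trans (length-map (fiberSize c) (allFinL r)) (length-tabulate {n = r} id)

other : Fin 2 → Fin 2
other 0F = 1F
other 1F = 0F

other-≢ : ∀ x → other x ≢ x
other-≢ 0F ()
other-≢ 1F ()

≢⇒≡other : ∀ {x y : Fin 2} → x ≢ y → x ≡ other y
≢⇒≡other {0F} {0F} x≢y = ⊥-elim (x≢y refl)
≢⇒≡other {0F} {1F} _ = refl
≢⇒≡other {1F} {0F} _ = refl
≢⇒≡other {1F} {1F} x≢y = ⊥-elim (x≢y refl)

≡⊎≡other : ∀ (x y : Fin 2) → x ≡ y ⊎ x ≡ other y
≡⊎≡other x y with x ≟ y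
... | yes x≡y = inj₁ x≡y
... | no x≢y = inj₂ (≢⇒≡other x≢y)

≢⇒≡⊎≡ : ∀ {x y : Fin 2} → x ≢ y → ∀ z → x ≡ z ⊎ y ≡ z
≢⇒≡⊎≡ {x} x≢y z with x ≟ z
... | yes x≡z = inj₁ x≡z
... | no x≢z = inj₂ (trans (≢⇒≡other (x≢y ∘ sym)) (sym (≢⇒≡other (x≢z ∘ sym))))

map-allFin2-↭ : ∀ {A : Set} (f : Fin 2 → A) z → f z ∷ f (other z) ∷ [] ↭ map f (allFinL 2)
map-allFin2-↭ f 0F = ↭-refl
map-allFin2-↭ f 1F = swap _ _ ↭-refl

classify : (α β : Fin 2) → Fin 2 → Fin 2 → Fin 3
classify α β x y with x ≟ α | y ≟ β
... | no _  | _     = 0F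
... | yes _ | yes _ = 1F
... | yes _ | no _  = 2F

module _ {α β x y : Fin 2} where

  classify≡0⁻ : classify α β x y ≡ 0F → x ≡ other α
  classify≡0⁻ e with x ≟ α | y ≟ β
  classify≡0⁻ () | yes _ | yes _
  classify≡0⁻ () | yes _ | no _
  ... | no x≢α | _ = ≢⇒≡other x≢α

  classify≡1⁻ : classify α β x y ≡ 1F → x ≡ α × y ≡ β
  classify≡1⁻ e with x ≟ α | y ≟ β
  classify≡1⁻ () | no _ | _
  classify≡1⁻ () | yes _ | no _
  ... | yes x≡α | yes y≡β = x≡α , y≡β

  classify≡2⁻ : classify α β x y ≡ 2F → x ≡ α × y ≡ other β
  classify≡2⁻ e with x ≟ α | y ≟ β
  classify≡2⁻ () | no _ | _
  classify≡2⁻ () | yes _ | yes _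
  ... | yes x≡α | no y≢β = x≡α , ≢⇒≡other y≢β

  classify≡0⁺ : x ≡ other α → classify α β x y ≡ 0F
  classify≡0⁺ x≡α′ with x ≟ α
  ... | yes x≡α = ⊥-elim (other-≢ α (trans (sym x≡α′) x≡α))
  ... | no _ = refl

  classify≡1⁺ : x ≡ α → y ≡ β → classify α β x y ≡ 1F
  classify≡1⁺ x≡α y≡β with x ≟ α | y ≟ β
  ... | no x≢α | _ = ⊥-elim (x≢α x≡α)
  ... | yes _ | no y≢β = ⊥-elim (y≢β y≡β)
  ... | yes _ | yes _ = refl

  classify≡2⁺ : x ≡ α → y ≡ other β → classify α β x y ≡ 2F
  classify≡2⁺ x≡α y≡β′ with x ≟ α | y ≟ β
  ... | no x≢α | _ = ⊥-elim (x≢α x≡α)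
  ... | yes _ | yes y≡β = ⊥-elim (other-≢ β (trans (sym y≡β′) y≡β))
  ... | yes _ | no _ = refl

module _ {m n} {E : Edges m n} where

  Reach-trans : ∀ {S u v w} → Reach E S u v → Reach E S v w → Reach E S u w
  Reach-trans here q = q
  Reach-trans (step j ¬Sj joins r) q = step j ¬Sj joins (Reach-trans r q)

  Reach-sym : ∀ {S u v} → Reach E S u v → Reach E S v u
  Reach-sym here = here
  Reach-sym (step j ¬Sj joins r) = Reach-trans (Reach-sym r) (step j ¬Sj (Joins-sym joins) here)
    where
      Joins-sym : ∀ {p : Fin n × Fin n} {u v} → Joins p u v → Joins p v u
      Joins-sym (inj₁ e) = inj₂ e
      Joins-sym (inj₂ e) = inj₁ e

  Reach-mono : ∀ {S S′ : Fin m → Set} {u v} → S′ ⊆ S → Reach E S u v → Reach E S′ u v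
  Reach-mono S′⊆S here = here
  Reach-mono S′⊆S (step j ¬Sj joins r) = step j (¬Sj ∘ S′⊆S) joins (Reach-mono S′⊆S r)

  ReachesEndpoint : (Fin m → Set) → Fin n → Fin m → Set
  ReachesEndpoint S u b = Reach E S u (proj₁ (E b)) ⊎ Reach E S u (proj₂ (E b))

  -- Cut the path at its first use of b.
  Reach-avoid⊎reachesEndpoint : ∀ {S u v} b → Reach E S u v →
    Reach E (S ∪ SingleEdge b) u v ⊎ ReachesEndpoint (S ∪ SingleEdge b) u b
  Reach-avoid⊎reachesEndpoint b here = inj₁ here
  Reach-avoid⊎reachesEndpoint {S} b (step j ¬Sj joins r) with j ≟ b
  ... | yes refl = inj₂ (endpoint joins)
    where
      endpoint : ∀ {S′ p u u′} → Joins p u u′ → Reach E S′ u (proj₁ p) ⊎ Reach E S′ u (proj₂ p)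
      endpoint (inj₁ (refl , _)) = inj₁ here
      endpoint (inj₂ (_ , refl)) = inj₂ here
  ... | no j≢b = Sum.map (step j ¬S∪bj joins) (Sum.map (step j ¬S∪bj joins) (step j ¬S∪bj joins))
                         (Reach-avoid⊎reachesEndpoint b r)
    where
      ¬S∪bj : ¬ (S ∪ SingleEdge b) j
      ¬S∪bj = Sum.[ ¬Sj , j≢b ]

record ComponentLabelling {m n} (E : Edges m n) (S : Fin m → Set) (r : ℕ) : Set where
  field
    label    : Fin n → Fin r
    onto     : ∀ j → ∃ λ u → label u ≡ j
    sound    : ∀ u v → label u ≡ label v → Reach E S u v
    complete : ∀ u v → Reach E S u v → label u ≡ label v

module _ {m n} {E : Edges m n} {S : Fin m → Set} where

  θ-elim : ∀ {λ′} → θ E S λ′ →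
    Decreasing λ′ × Σ (ComponentLabelling E S (length λ′)) λ C →
      map (fiberSize (ComponentLabelling.label C)) (allFinL (length λ′)) ↭ λ′
  θ-elim (dec , r , c , onto , sound , complete , sizes)
    with trans (sym (length-fiberSizes c)) (↭-length sizes)
  ... | refl = dec , record { label = c ; onto = onto ; sound = sound ; complete = complete } , sizes

  θ-intro : ∀ {r λ′} (C : ComponentLabelling E S r) →
    map (fiberSize (ComponentLabelling.label C)) (allFinL r) ↭ λ′ → θ E S (re λ′)
  θ-intro {λ′ = λ′} C sizes =
    re-decreasing λ′ , _ , label , onto , sound , complete , ↭-trans sizes (↭-sym (re-↭ λ′))
    where open ComponentLabelling C

module TwoEdgeCut {m n} {E : Edges m n} (tree : IsTree E) {a b : Fin m} (a≢b : a ≢ b)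
  (A : ComponentLabelling E (SingleEdge a) 2) (B : ComponentLabelling E (SingleEdge b) 2) where

  open ComponentLabelling A using () renaming (label to sideA; onto to ontoA; sound to soundA; complete to completeA)
  open ComponentLabelling B using () renaming (label to sideB; sound to soundB; complete to completeB)

  p q : Fin n
  p = proj₁ (E b)
  q = proj₂ (E b)

  Reach₂ : Fin n → Fin n → Set
  Reach₂ = Reach E (TwoEdges a b)

  Reach₂⇒sameSideA : ∀ {u v} → Reach₂ u v → sideA u ≡ sideA v
  Reach₂⇒sameSideA r = completeA _ _ (Reach-mono inj₁ r)

  Reach₂⇒sameSideB : ∀ {u v} → Reach₂ u v → sideB u ≡ sideB v
  Reach₂⇒sameSideB r = completeB _ _ (Reach-mono inj₂ r)

  endpoints-sameSideA : sideA p ≡ sideA q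
  endpoints-sameSideA = completeA p q (step b (a≢b ∘ sym) (inj₁ (refl , refl)) here)

  endpoints-otherSideB : sideB p ≢ sideB q
  endpoints-otherSideB e = IsTree.acyclic tree b (soundB p q e)

  sameSides⇒Reach₂ : ∀ {u v} → sideA u ≡ sideA v → sideB u ≡ sideB v → Reach₂ u v
  sameSides⇒Reach₂ {u} {v} eA eB
    with Reach-avoid⊎reachesEndpoint b (soundA u v eA) | Reach-avoid⊎reachesEndpoint b (soundA v u (sym eA))
  ... | inj₁ r | _ = r
  ... | inj₂ _ | inj₁ r = Reach-sym r
  ... | inj₂ (inj₁ up) | inj₂ (inj₁ vp) = Reach-trans up (Reach-sym vp)
  ... | inj₂ (inj₂ uq) | inj₂ (inj₂ vq) = Reach-trans uq (Reach-sym vq)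
  ... | inj₂ (inj₁ up) | inj₂ (inj₂ vq) = ⊥-elim (endpoints-otherSideB
          (trans (sym (Reach₂⇒sameSideB up)) (trans eB (Reach₂⇒sameSideB vq))))
  ... | inj₂ (inj₂ uq) | inj₂ (inj₁ vp) = ⊥-elim (endpoints-otherSideB
          (trans (sym (Reach₂⇒sameSideB vp)) (trans (sym eB) (Reach₂⇒sameSideB uq))))

  α : Fin 2
  α = sideA p

  far : Fin n
  far = proj₁ (ontoA (other α))

  far-sideA : sideA far ≡ other α
  far-sideA = proj₂ (ontoA (other α))

  β : Fin 2
  β = sideB far

  farSideA⇒sideB≡β : ∀ {u} → sideA u ≡ other α → sideB u ≡ β
  farSideA⇒sideB≡β {u} uFar
    with Reach-avoid⊎reachesEndpoint b (soundA u far (trans uFar (sym far-sideA)))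
  ... | inj₁ r = Reach₂⇒sameSideB r
  ... | inj₂ (inj₁ up) = ⊥-elim (other-≢ α (trans (sym uFar) (Reach₂⇒sameSideA up)))
  ... | inj₂ (inj₂ uq) =
    ⊥-elim (other-≢ α (trans (sym uFar) (trans (Reach₂⇒sameSideA uq) (sym endpoints-sameSideA))))

  endpoint-onSideB : ∀ y → ∃ λ u → sideA u ≡ α × sideB u ≡ y
  endpoint-onSideB y with ≢⇒≡⊎≡ endpoints-otherSideB y
  ... | inj₁ py = p , refl , py
  ... | inj₂ qy = q , sym endpoints-sameSideA , qy

  same : ∀ {A : Set} {x y z : A} → x ≡ z → y ≡ z → x ≡ y
  same x≡z y≡z = trans x≡z (sym y≡z)

  class : Fin n → Fin 3
  class u = classify α β (sideA u) (sideB u)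

  sameClass⇒sameSides : ∀ {u v} → class u ≡ class v → sideA u ≡ sideA v × sideB u ≡ sideB v
  sameClass⇒sameSides {u} {v} e with class u in cu
  ... | 0F = Product.zip same same (farSides (classify≡0⁻ cu)) (farSides (classify≡0⁻ (sym e)))
    where
      farSides : ∀ {w} → sideA w ≡ other α → sideA w ≡ other α × sideB w ≡ β
      farSides wFar = wFar , farSideA⇒sideB≡β wFar
  ... | 1F = Product.zip same same (classify≡1⁻ cu) (classify≡1⁻ (sym e))
  ... | 2F = Product.zip same same (classify≡2⁻ cu) (classify≡2⁻ (sym e))

  labelling : ComponentLabelling E (TwoEdges a b) 3
  labelling = record
    { label    = class
    ; onto     = onto
    ; sound    = λ u v → Product.uncurry sameSides⇒Reach₂ ∘ sameClass⇒sameSides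
    ; complete = λ u v r → cong₂ (classify α β) (Reach₂⇒sameSideA r) (Reach₂⇒sameSideB r)
    }
    where
      onto : ∀ j → ∃ λ u → class u ≡ j
      onto 0F = far , classify≡0⁺ far-sideA
      onto 1F = Product.map₂ (Product.uncurry classify≡1⁺) (endpoint-onSideB β)
      onto 2F = Product.map₂ (Product.uncurry classify≡2⁺) (endpoint-onSideB (other β))

  X Y Z : ℕ
  X = fiberSize class 0F
  Y = fiberSize class 1F
  Z = fiberSize class 2F

  sizeA-far : fiberSize sideA (other α) ≡ X
  sizeA-far = fiberSize-≐ sideA class (classify≡0⁺ , classify≡0⁻)

  sizeA-near : fiberSize sideA α ≡ Y + Z
  sizeA-near =
    fiberSize-∪ sideA class (λ ()) (split , Sum.[ proj₁ ∘ classify≡1⁻ , proj₁ ∘ classify≡2⁻ ])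
    where
      split : ∀ {u} → sideA u ≡ α → class u ≡ 1F ⊎ class u ≡ 2F
      split {u} uNear = Sum.map (classify≡1⁺ uNear) (classify≡2⁺ uNear) (≡⊎≡other (sideB u) β)

  sizeB-β : fiberSize sideB β ≡ X + Y
  sizeB-β =
    fiberSize-∪ sideB class (λ ()) (split , Sum.[ farSideA⇒sideB≡β ∘ classify≡0⁻ , proj₂ ∘ classify≡1⁻ ])
    where
      split : ∀ {u} → sideB u ≡ β → class u ≡ 0F ⊎ class u ≡ 1F
      split {u} uβ with ≡⊎≡other (sideA u) α
      ... | inj₁ uNear = inj₂ (classify≡1⁺ uNear uβ)
      ... | inj₂ uFar = inj₁ (classify≡0⁺ uFar)

  sizeB-other : fiberSize sideB (other β) ≡ Z
  sizeB-other = fiberSize-≐ sideB class (toClass2 , proj₂ ∘ classify≡2⁻)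
    where
      toClass2 : ∀ {u} → sideB u ≡ other β → class u ≡ 2F
      toClass2 {u} u∉β with ≡⊎≡other (sideA u) α
      ... | inj₁ uNear = classify≡2⁺ uNear u∉β
      ... | inj₂ uFar = ⊥-elim (other-≢ β (trans (sym u∉β) (farSideA⇒sideB≡β uFar)))

  sizesA : Y + Z ∷ X ∷ [] ↭ map (fiberSize sideA) (allFinL 2)
  sizesA = ↭-trans (↭-reflexive (cong₂ (λ s t → s ∷ t ∷ []) (sym sizeA-near) (sym sizeA-far)))
                   (map-allFin2-↭ (fiberSize sideA) α)

  sizesB : X + Y ∷ Z ∷ [] ↭ map (fiberSize sideB) (allFinL 2)
  sizesB = ↭-trans (↭-reflexive (cong₂ (λ s t → s ∷ t ∷ []) (sym sizeB-β) (sym sizeB-other)))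
                   (map-allFin2-↭ (fiberSize sideB) β)

  Y-nonempty : 0 < Y
  Y-nonempty = fiberSize-nonempty class (proj₂ (onto 1F))
    where open ComponentLabelling labelling

+≡⇒≡∸ : ∀ {y k m} → y + k ≡ m → y ≡ m ∸ k
+≡⇒≡∸ {y} {k} y+k≡m = trans (sym (m+n∸n≡m y k)) (cong (_∸ k) y+k≡m)

∸-twice : ∀ n i → n ∸ i ∸ i ≡ n ∸ 2 * i
∸-twice n i = trans (∸-+-assoc n i i) (cong (λ t → n ∸ (i + t)) (sym (+-identityʳ i)))

two-cut-sizes : ∀ {n i k X Y Z} → 0 < Y → k ≤ i → i ≤ n ∸ i →
  Y + Z ∷ X ∷ [] ↭ n ∸ i ∷ i ∷ [] → X + Y ∷ Z ∷ [] ↭ n ∸ k ∷ k ∷ [] →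
  Z ≡ k × (X ≡ i × Y + k ≡ n ∸ i ⊎ X ≡ n ∸ i × Y + k ≡ i)
two-cut-sizes {Y = suc _} _ k≤i i≤n∸i sidesA sidesB with ↭-pair-inv sidesA | ↭-pair-inv sidesB
... | inj₁ (Y+Z≡n∸i , refl) | inj₁ (_ , refl) = refl , inj₁ (refl , Y+Z≡n∸i)
... | inj₂ (Y+Z≡i , refl) | inj₁ (_ , refl) = refl , inj₂ (refl , Y+Z≡i)
... | inj₁ (_ , refl) | inj₂ (X+Y≡k , _) = ⊥-elim (m+1+n≰m _ (≤-trans (≤-reflexive X+Y≡k) k≤i))
... | inj₂ (_ , refl) | inj₂ (X+Y≡k , _) =
  ⊥-elim (m+1+n≰m _ (≤-trans (≤-reflexive X+Y≡k) (≤-trans k≤i i≤n∸i)))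

three-part-sizes : ∀ {n i k X Y Z} → 0 < Y → k ≤ i → i ≤ n ∸ i →
  Y + Z ∷ X ∷ [] ↭ n ∸ i ∷ i ∷ [] → X + Y ∷ Z ∷ [] ↭ n ∸ k ∷ k ∷ [] →
  (k ≡ i → X ∷ Y ∷ Z ∷ [] ↭ n ∸ 2 * i ∷ i ∷ i ∷ []) ×
  (k < i → X ∷ Y ∷ Z ∷ [] ↭ n ∸ i ∸ k ∷ i ∷ k ∷ []
         ⊎ X ∷ Y ∷ Z ∷ [] ↭ n ∸ i ∷ i ∸ k ∷ k ∷ [])
three-part-sizes {n} {i} {k} {Y = Y} 0<Y k≤i i≤n∸i sidesA sidesB
  with two-cut-sizes 0<Y k≤i i≤n∸i sidesA sidesB
... | refl , inj₁ (refl , Y+k≡n∸i) =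
  (λ { refl → swap-head (trans Y≡n∸i∸k (∸-twice n i)) }) , λ _ → inj₁ (swap-head Y≡n∸i∸k)
  where
    Y≡n∸i∸k : Y ≡ n ∸ i ∸ k
    Y≡n∸i∸k = +≡⇒≡∸ Y+k≡n∸i

    swap-head : ∀ {y zs} → Y ≡ y → i ∷ Y ∷ zs ↭ y ∷ i ∷ zs
    swap-head {zs = zs} Y≡y = ↭-trans (swap i Y ↭-refl) (↭-reflexive (cong (λ y → y ∷ i ∷ zs) Y≡y))
... | refl , inj₂ (refl , Y+k≡i) =
  (λ { refl → ⊥-elim (<⇒≢ 0<Y (sym (trans Y≡i∸k (n∸n≡0 i)))) }) , λ _ → inj₂ Y-middle
  where
    Y≡i∸k : Y ≡ i ∸ k
    Y≡i∸k = +≡⇒≡∸ Y+k≡i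

    Y-middle : n ∸ i ∷ Y ∷ k ∷ [] ↭ n ∸ i ∷ i ∸ k ∷ k ∷ []
    Y-middle = ↭-reflexive (cong (λ y → n ∸ i ∷ y ∷ k ∷ []) Y≡i∸k)

proposition5p2 : ∀ {m n} (E : Edges m n) → IsTree E →
    (a b : Fin m) → a ≢ b → (i k : ℕ) →
    θ E (SingleEdge a) (n ∸ i ∷ i ∷ []) →
    θ E (SingleEdge b) (n ∸ k ∷ k ∷ []) →
    k ≤ i →
    (k ≡ i → θ E (TwoEdges a b) (re (n ∸ 2 * i ∷ i ∷ i ∷ []))) ×
    (k < i → θ E (TwoEdges a b) (re (n ∸ i ∸ k ∷ i ∷ k ∷ []))
           ⊎ θ E (TwoEdges a b) (re (n ∸ i ∷ i ∸ k ∷ k ∷ [])))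
proposition5p2 E tree a b a≢b i k θa θb k≤i with θ-elim θa | θ-elim θb
... | i≤n∸i ∷ _ , A , fibersA | _ , B , fibersB =
  Product.map (θ-intro labelling ∘_)
              (λ split k<i → Sum.map (θ-intro labelling) (θ-intro labelling) (split k<i))
    (three-part-sizes Y-nonempty k≤i i≤n∸i (↭-trans sizesA fibersA) (↭-trans sizesB fibersB))
  where open TwoEdgeCut tree a≢b A B
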